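{- Let $K$ be a valued field of characteristic $0$ and let $A\subset K$ be a finite subset. If $K$ has finite residue characteristic $p$, let $\ell$ be any natural number with $\#A<p^\ell$ and set $\lambda:=|p^\ell|$; if $K$ has residue characteristic $0$, set $\lambda:=1$. Then for any $a,a'\in A$, \[ a=a' \iff \{\mathrm{rv}_\lambda(a-v): v\in A\}=\{\mathrm{rv}_\lambda(a'-v): v\in A\}. \]
   Context: The valuation is written multiplicatively, $|x|$. For $\lambda\le1$ in the value group, $B_{<\lambda}(1)=\{x:|x-1|<\lambda\}$ is a subgroup of $K^\times$, $\mathrm{RV}_{\lambda,K}:=(K^\times/B_{<\lambda}(1))\cup\{0\}$, and $\mathrm{rv}_\lambda:K\to\mathrm{RV}_{\lambda,K}$ is the canonical map (sending $0$ to $0$). -}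

module Defs where

open import Level using (0ℓ)
open import Data.Nat using (ℕ; zero; suc) renaming (_<_ to _<ℕ_; _≤_ to _≤ℕ_)
open import Data.Maybe using (Maybe; just; nothing)
open import Data.Product using (Σ; _×_; _,_; ∃)
open import Data.Sum using (_⊎_)
open import Data.Empty using (⊥)
open import Data.Unit using (⊤)
open import Data.List using (List)
open import Data.List.Membership.Propositional using (_∈_)
open import Relation.Nullary using (¬_)
open import Relation.Binary.PropositionalEquality using (_≡_; _≢_)
open import Relation.Binary.Structures using (IsTotalOrder)
open import Algebra.Structures using (IsCommutativeRing; IsAbelianGroup)

-- Γ ∪ {0}, with 0 represented by 'nothing': multiplication and order
mul₀ : {Γ : Set} → (Γ → Γ → Γ) → Maybe Γ → Maybe Γ → Maybe Γ
mul₀ m (just a) (just b) = just (m a b)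
mul₀ m _ _ = nothing

le₀ : {Γ : Set} → (Γ → Γ → Set) → Maybe Γ → Maybe Γ → Set
le₀ le nothing _ = ⊤
le₀ le (just a) nothing = ⊥
le₀ le (just a) (just b) = le a b

-- A valued field, valuation written multiplicatively: abs : K → Γ ∪ {0},
-- where Γ is a (multiplicatively written) totally ordered abelian group and
-- the extra element 0 (represented by 'nothing') is below all of Γ.
record ValuedField : Set₁ where
  infixl 6 _+_ _-_
  infixl 7 _*_
  field
    K        : Set
    _+_ _*_  : K → K → K
    -_       : K → K
    0# 1#    : K
    isCommutativeRing : IsCommutativeRing _≡_ _+_ _*_ -_ 0# 1#
    0≢1      : 0# ≢ 1#
    _⁻¹      : K → K
    inverseʳ : ∀ x → x ≢ 0# → x * (x ⁻¹) ≡ 1#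
    Γ        : Set
    _·_      : Γ → Γ → Γ
    ε        : Γ
    _ⁱ       : Γ → Γ
    isAbelianGroup : IsAbelianGroup _≡_ _·_ ε _ⁱ
    _≤Γ_     : Γ → Γ → Set
    isTotalOrder : IsTotalOrder _≡_ _≤Γ_
    ·-monoˡ  : ∀ {x y} z → x ≤Γ y → (x · z) ≤Γ (y · z)
    abs      : K → Maybe Γ
    ∣x∣≡0⇒x≡0 : ∀ x → abs x ≡ nothing → x ≡ 0#
    ∣0∣≡0    : abs 0# ≡ nothing
    ∣xy∣     : ∀ x y → abs (x * y) ≡ mul₀ _·_ (abs x) (abs y)
    ultra    : ∀ x y → le₀ _≤Γ_ (abs (x + y)) (abs x) ⊎ le₀ _≤Γ_ (abs (x + y)) (abs y)

  _-_ : K → K → K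
  x - y = x + (- y)

  _≤₀_ : Maybe Γ → Maybe Γ → Set
  _≤₀_ = le₀ _≤Γ_

  _<₀_ : Maybe Γ → Maybe Γ → Set
  u <₀ v = (u ≤₀ v) × (u ≢ v)

  one₀ : Maybe Γ
  one₀ = just ε

  natCast : ℕ → K
  natCast zero = 0#
  natCast (suc n) = 1# + natCast n

  CharZero : Set
  CharZero = ∀ n → natCast (suc n) ≢ 0#

  -- n·1 lies in the maximal ideal of the valuation ring, i.e. is 0 in the residue field
  InMaxIdeal : K → Set
  InMaxIdeal x = abs x <₀ one₀

  ResidueChar : ℕ → Set
  ResidueChar p = (1 ≤ℕ p) × InMaxIdeal (natCast p)
                  × (∀ m → 1 ≤ℕ m → m <ℕ p → ¬ InMaxIdeal (natCast m))

  ResidueCharZero : Set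
  ResidueCharZero = ∀ n → ¬ InMaxIdeal (natCast (suc n))

  -- equality in RV_λ = (K^× / B_{<λ}(1)) ∪ {0}:  rv_λ(x) = rv_λ(y)
  -- iff x = y = 0, or x,y ≠ 0 and x y⁻¹ ∈ B_{<λ}(1), i.e. |x y⁻¹ - 1| < λ
  RVEq : Maybe Γ → K → K → Set
  RVEq λ' x y = (x ≡ 0# × y ≡ 0#)
              ⊎ ((x ≢ 0#) × (y ≢ 0#) × (abs (x * (y ⁻¹) - 1#) <₀ λ'))

  -- the finite set {rv_λ(a - v) : v ∈ A}, compared as subsets of RV_λ:
  -- {rv_λ(a-v) : v∈A} = {rv_λ(a'-v) : v∈A}
  RVSetEq : Maybe Γ → List K → K → K → Set
  RVSetEq λ' A a a' =
      (∀ v → v ∈ A → Σ K λ w → (w ∈ A) × RVEq λ' (a - v) (a' - w))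
    × (∀ w → w ∈ A → Σ K λ v → (v ∈ A) × RVEq λ' (a - v) (a' - w))

-- Suppose d = a - a' ≠ 0 and the two sets of residues agree. Matching each a' - w with some a - v
-- produces a walk v₀ = a, v₁, v₂, … in A with rv_λ(a - v_{k+1}) = rv_λ((a - v_k) - d), so by the
-- ultrametric inequality a - v_k stays within λ|d| of -k·d. A walk in A repeats within #A steps,
-- which makes m·d λ|d|-close to 0, i.e. |m| < λ, for some 1 ≤ m ≤ #A. The choice of λ excludes
-- this: every |m| is 1 in residue characteristic 0, and |m| ≥ |p^ℓ| whenever 1 ≤ m < p^ℓ.
module Submission where

open import Defs
open import Data.Nat using (ℕ; _^_; _<_)
open import Data.List using (List; length)
open import Data.List.Membership.Propositional using (_∈_)
open import Data.List.Relation.Unary.Unique.Propositional using (Unique)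
open import Data.Product using (_×_)
open import Function.Bundles using (_⇔_)
open import Relation.Binary.PropositionalEquality using (_≡_)

open import Level using (Level; 0ℓ)
open import Algebra.Bundles using (AbelianGroup; CommutativeRing)
import Algebra.Properties.AbelianGroup as AbelianGroupProperties
import Algebra.Properties.CommutativeSemigroup as CommutativeSemigroupProperties
import Algebra.Properties.Ring as RingProperties
open import Data.Empty using (⊥; ⊥-elim)
open import Data.Fin using (toℕ)
open import Data.Fin.Properties using (pigeonhole; toℕ<n)
open import Data.List using (lookup)
open import Data.List.Relation.Unary.Any using (index)
open import Data.List.Relation.Unary.Any.Properties using (lookup-index)
open import Data.Maybe using (Maybe; just; nothing)
open import Data.Maybe.Properties using (just-injective)
import Data.Nat as ℕ
open import Data.Nat using (zero; suc; _∸_; _≤_; z≤n; s≤s; _%_; _/_)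
open import Data.Nat.DivMod using (m≡m%n+[m/n]*n; m%n<n)
open import Data.Nat.Properties
  using (n<1+n; m<1+n⇒m≤n; ≤-trans; ≤-<-trans; <⇒≤; m^n>0; m∸n≤m; m<n⇒0<n∸m; m+[n∸m]≡n; *-comm; *-cancelʳ-<)
open import Data.Product using (Σ; ∃; _,_; proj₁; proj₂; map₂)
open import Data.Sum using (inj₁; inj₂; [_,_]′)
open import Data.Unit using (tt)
open import Function.Base using (_∘′_)
open import Function.Bundles using (mk⇔)
open import Relation.Binary.PropositionalEquality
  using (_≢_; refl; sym; trans; cong; cong₂; subst; subst₂; module ≡-Reasoning)
open import Relation.Binary.Structures using (IsTotalOrder)
open import Relation.Nullary using (¬_)

module AbelianGroupIdentities {a ℓ : Level} (G : AbelianGroup a ℓ) where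
  open AbelianGroup G
  open AbelianGroupProperties G
  open CommutativeSemigroupProperties commutativeSemigroup using (interchange)
  open import Relation.Binary.Reasoning.Setoid setoid

  [x∙z]-[y∙z]≈x-y : ∀ x y z → (x ∙ z) - (y ∙ z) ≈ x - y
  [x∙z]-[y∙z]≈x-y x y z = begin
    (x ∙ z) ∙ (y ∙ z) ⁻¹      ≈⟨ ∙-congˡ (⁻¹-∙-comm y z) ⟨
    (x ∙ z) ∙ (y ⁻¹ ∙ z ⁻¹)   ≈⟨ interchange x z (y ⁻¹) (z ⁻¹) ⟩
    (x - y) ∙ (z ∙ z ⁻¹)      ≈⟨ ∙-congˡ (inverseʳ z) ⟩
    (x - y) ∙ ε               ≈⟨ identityʳ (x - y) ⟩
    x - y                     ∎

  [x∙[y∙z]]-[x∙y]≈z : ∀ x y z → (x ∙ (y ∙ z)) - (x ∙ y) ≈ z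
  [x∙[y∙z]]-[x∙y]≈z x y z = begin
    (x ∙ (y ∙ z)) - (x ∙ y)   ≈⟨ ∙-congʳ (assoc x y z) ⟨
    ((x ∙ y) ∙ z) - (x ∙ y)   ≈⟨ ∙-congʳ (comm (x ∙ y) z) ⟩
    (z ∙ (x ∙ y)) - (x ∙ y)   ≈⟨ //-rightDividesʳ (x ∙ y) z ⟩
    z                         ∎

  [w-[x-y]]∙[x∙z]≈w∙[y∙z] : ∀ w x y z → (w - (x - y)) ∙ (x ∙ z) ≈ w ∙ (y ∙ z)
  [w-[x-y]]∙[x∙z]≈w∙[y∙z] w x y z = begin
    (w ∙ (x - y) ⁻¹) ∙ (x ∙ z)   ≈⟨ ∙-congʳ (∙-congˡ (⁻¹-anti-homo‿- x y)) ⟩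
    (w ∙ (y ∙ x ⁻¹)) ∙ (x ∙ z)   ≈⟨ assoc w (y ∙ x ⁻¹) (x ∙ z) ⟩
    w ∙ ((y ∙ x ⁻¹) ∙ (x ∙ z))   ≈⟨ ∙-congˡ (assoc y (x ⁻¹) (x ∙ z)) ⟩
    w ∙ (y ∙ (x ⁻¹ ∙ (x ∙ z)))   ≈⟨ ∙-congˡ (∙-congˡ (\\-leftDividesʳ x z)) ⟩
    w ∙ (y ∙ z)                  ∎

  [x-z]-[x-y]≈y-z : ∀ x y z → (x - z) - (x - y) ≈ y - z
  [x-z]-[x-y]≈y-z x y z = begin
    (x ∙ z ⁻¹) ∙ (x - y) ⁻¹      ≈⟨ ∙-congˡ (⁻¹-anti-homo‿- x y) ⟩
    (x ∙ z ⁻¹) ∙ (y ∙ x ⁻¹)      ≈⟨ ∙-congˡ (comm y (x ⁻¹)) ⟩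
    (x ∙ z ⁻¹) ∙ (x ⁻¹ ∙ y)      ≈⟨ interchange x (z ⁻¹) (x ⁻¹) y ⟩
    (x ∙ x ⁻¹) ∙ (z ⁻¹ ∙ y)      ≈⟨ ∙-congʳ (inverseʳ x) ⟩
    ε ∙ (z ⁻¹ ∙ y)               ≈⟨ identityˡ (z ⁻¹ ∙ y) ⟩
    z ⁻¹ ∙ y                     ≈⟨ comm (z ⁻¹) y ⟩
    y - z                        ∎

module _ {X : Set} (A : List X) where

  predecessor-walk : {R : X → X → Set} → (∀ w → w ∈ A → Σ X λ v → v ∈ A × R v w) →
                    ∀ {a} → a ∈ A →
                    Σ (ℕ → X) λ v → v 0 ≡ a × (∀ k → v k ∈ A) × (∀ k → R (v (suc k)) (v k))
  predecessor-walk {R} pred {a} a∈A = (λ k → proj₁ (walk k)) , refl , (λ k → proj₂ (walk k)) , step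
    where
      walk : ℕ → Σ X (_∈ A)
      walk zero = a , a∈A
      walk (suc k) = map₂ proj₁ (pred (proj₁ (walk k)) (proj₂ (walk k)))

      step : ∀ k → R (proj₁ (walk (suc k))) (proj₁ (walk k))
      step k = proj₂ (proj₂ (pred (proj₁ (walk k)) (proj₂ (walk k))))

  walk-repeats : (v : ℕ → X) → (∀ k → v k ∈ A) →
                 Σ ℕ λ i → Σ ℕ λ m → 1 ≤ m × m ≤ length A × v i ≡ v (i ℕ.+ m)
  walk-repeats v v∈A with pigeonhole (n<1+n (length A)) (λ i → index (v∈A (toℕ i)))
  ... | i , j , i<j , same-index =
    toℕ i , toℕ j ∸ toℕ i , m<n⇒0<n∸m i<j ,
    ≤-trans (m∸n≤m (toℕ j) (toℕ i)) (m<1+n⇒m≤n (toℕ<n j)) ,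
    subst (λ n → v (toℕ i) ≡ v n) (sym (m+[n∸m]≡n (<⇒≤ i<j))) vᵢ≡vⱼ
    where
      vᵢ≡vⱼ : v (toℕ i) ≡ v (toℕ j)
      vᵢ≡vⱼ = trans (lookup-index (v∈A (toℕ i)))
                (trans (cong (lookup A) same-index) (sym (lookup-index (v∈A (toℕ j)))))

module _ (V : ValuedField) where
  open ValuedField V
  open ≡-Reasoning

  private
    ring : CommutativeRing 0ℓ 0ℓ
    ring = record { isCommutativeRing = isCommutativeRing }

    valueGroup : AbelianGroup 0ℓ 0ℓ
    valueGroup = record { isAbelianGroup = isAbelianGroup }

    module R = CommutativeRing ring
    module RP = RingProperties R.ring
    module +P = AbelianGroupProperties R.+-abelianGroup
    module +I = AbelianGroupIdentities R.+-abelianGroup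
    module VG = AbelianGroup valueGroup
    module VGP = AbelianGroupProperties valueGroup
    module ≤Γ = IsTotalOrder isTotalOrder

  x-y≡0⇒x≡y : ∀ x y → x - y ≡ 0# → x ≡ y
  x-y≡0⇒x≡y = +P.x∙y⁻¹≈ε⇒x≈y

  [xy⁻¹-1]y≡x-y : ∀ x y → y ≢ 0# → (x * y ⁻¹ - 1#) * y ≡ x - y
  [xy⁻¹-1]y≡x-y x y y≢0 = begin
    (x * y ⁻¹ - 1#) * y        ≡⟨ RP.[y-z]x≈yx-zx y (x * y ⁻¹) 1# ⟩
    x * y ⁻¹ * y - 1# * y      ≡⟨ cong₂ _-_ (R.*-assoc x (y ⁻¹) y) (R.*-identityˡ y) ⟩
    x * (y ⁻¹ * y) - y         ≡⟨ cong (λ t → x * t - y) (trans (R.*-comm (y ⁻¹) y) (inverseʳ y y≢0)) ⟩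
    x * 1# - y                 ≡⟨ cong (_- y) (R.*-identityʳ x) ⟩
    x - y                      ∎

  natCast-+ : ∀ m n → natCast (m ℕ.+ n) ≡ natCast m + natCast n
  natCast-+ zero n = sym (R.+-identityˡ (natCast n))
  natCast-+ (suc m) n = trans (cong (1# +_) (natCast-+ m n)) (sym (R.+-assoc 1# (natCast m) (natCast n)))

  natCast-suc-* : ∀ n x → natCast (suc n) * x ≡ x + natCast n * x
  natCast-suc-* n x = trans (R.distribʳ x 1# (natCast n)) (cong (_+ natCast n * x) (R.*-identityˡ x))

  natCast-* : ∀ m n → natCast (m ℕ.* n) ≡ natCast m * natCast n
  natCast-* zero n = sym (R.zeroˡ (natCast n))
  natCast-* (suc m) n = begin
    natCast (n ℕ.+ m ℕ.* n)             ≡⟨ natCast-+ n (m ℕ.* n) ⟩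
    natCast n + natCast (m ℕ.* n)       ≡⟨ cong (natCast n +_) (natCast-* m n) ⟩
    natCast n + natCast m * natCast n   ≡⟨ natCast-suc-* m (natCast n) ⟨
    natCast (suc m) * natCast n         ∎

  ·-monoʳ : ∀ {x y} z → x ≤Γ y → (z · x) ≤Γ (z · y)
  ·-monoʳ {x} {y} z x≤y = subst₂ _≤Γ_ (VG.comm x z) (VG.comm y z) (·-monoˡ z x≤y)

  ·-cancelʳ-≤ : ∀ {x y} z → (x · z) ≤Γ (y · z) → x ≤Γ y
  ·-cancelʳ-≤ {x} {y} z xz≤yz = subst₂ _≤Γ_ (VGP.//-rightDividesʳ z x) (VGP.//-rightDividesʳ z y) (·-monoˡ (z ⁱ) xz≤yz)

  g·g≡ε⇒g≡ε : ∀ g → g · g ≡ ε → g ≡ ε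
  g·g≡ε⇒g≡ε g g·g≡ε with ≤Γ.total g ε
  ... | inj₁ g≤ε = ≤Γ.antisym g≤ε (subst₂ _≤Γ_ g·g≡ε (VG.identityˡ g) (·-monoˡ g g≤ε))
  ... | inj₂ ε≤g = ≤Γ.antisym (subst₂ _≤Γ_ (VG.identityˡ g) g·g≡ε (·-monoˡ g ε≤g)) ε≤g

  infixl 25 _⊗_
  _⊗_ : Maybe Γ → Maybe Γ → Maybe Γ
  _⊗_ = mul₀ _·_

  ≤₀-refl : ∀ u → u ≤₀ u
  ≤₀-refl nothing = tt
  ≤₀-refl (just _) = ≤Γ.refl

  ≤₀-trans : ∀ {u v w} → u ≤₀ v → v ≤₀ w → u ≤₀ w
  ≤₀-trans {nothing} _ _ = tt
  ≤₀-trans {just _} {just _} {just _} u≤v v≤w = ≤Γ.trans u≤v v≤w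

  ≤₀-antisym : ∀ {u v} → u ≤₀ v → v ≤₀ u → u ≡ v
  ≤₀-antisym {nothing} {nothing} _ _ = refl
  ≤₀-antisym {just _} {just _} u≤v v≤u = cong just (≤Γ.antisym u≤v v≤u)

  ≤₀-<₀-trans : ∀ {u v w} → u ≤₀ v → v <₀ w → u <₀ w
  ≤₀-<₀-trans {u} {v} {w} u≤v (v≤w , v≢w) =
    ≤₀-trans {u} {v} {w} u≤v v≤w , λ u≡w → v≢w (≤₀-antisym v≤w (subst (_≤₀ v) u≡w u≤v))

  <₀-≤₀-trans : ∀ {u v w} → u <₀ v → v ≤₀ w → u <₀ w
  <₀-≤₀-trans {u} {v} {w} (u≤v , u≢v) v≤w =
    ≤₀-trans {u} {v} {w} u≤v v≤w , λ u≡w → u≢v (≤₀-antisym u≤v (subst (v ≤₀_) (sym u≡w) v≤w))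

  nothing<₀just : ∀ g → nothing <₀ just g
  nothing<₀just g = tt , λ ()

  ⊗-identityˡ : ∀ u → one₀ ⊗ u ≡ u
  ⊗-identityˡ nothing = refl
  ⊗-identityˡ (just g) = cong just (VG.identityˡ g)

  ⊗-monoˡ-≤₀ : ∀ {u v} w → u ≤₀ v → u ⊗ w ≤₀ v ⊗ w
  ⊗-monoˡ-≤₀ {nothing} w _ = tt
  ⊗-monoˡ-≤₀ {just _} {just _} nothing _ = tt
  ⊗-monoˡ-≤₀ {just _} {just _} (just g) u≤v = ·-monoˡ g u≤v

  ⊗-strictMonoˡ-<₀ : ∀ {u v} g → u <₀ v → u ⊗ just g <₀ v ⊗ just g
  ⊗-strictMonoˡ-<₀ {nothing} {nothing} g (_ , u≢v) = ⊥-elim (u≢v refl)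
  ⊗-strictMonoˡ-<₀ {nothing} {just _} g _ = nothing<₀just _
  ⊗-strictMonoˡ-<₀ {just x} {just y} g (x≤y , x≢y) =
    ·-monoˡ g x≤y , λ xg≡yg → x≢y (cong just (VGP.∙-cancelʳ g x y (just-injective xg≡yg)))

  ⊗-cancelʳ-<₀ : ∀ u v w → u ⊗ w <₀ v ⊗ w → u <₀ v
  ⊗-cancelʳ-<₀ nothing nothing w (_ , uw≢vw) = ⊥-elim (uw≢vw refl)
  ⊗-cancelʳ-<₀ nothing (just _) w _ = nothing<₀just _
  ⊗-cancelʳ-<₀ (just _) nothing nothing (_ , uw≢vw) = ⊥-elim (uw≢vw refl)
  ⊗-cancelʳ-<₀ (just _) nothing (just _) (() , _)
  ⊗-cancelʳ-<₀ (just _) (just _) nothing (_ , uw≢vw) = ⊥-elim (uw≢vw refl)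
  ⊗-cancelʳ-<₀ (just x) (just y) (just g) (xg≤yg , xg≢yg) =
    ·-cancelʳ-≤ g xg≤yg , λ x≡y → xg≢yg (cong (_⊗ just g) x≡y)

  abs≡just⇒≢0 : ∀ {x g} → abs x ≡ just g → x ≢ 0#
  abs≡just⇒≢0 {x} ∣x∣≡g x≡0 with () ← trans (sym ∣x∣≡g) (trans (cong abs x≡0) ∣0∣≡0)

  ≢0⇒abs≡just : ∀ x → x ≢ 0# → ∃ λ g → abs x ≡ just g
  ≢0⇒abs≡just x x≢0 with abs x in ∣x∣≡
  ... | nothing = ⊥-elim (x≢0 (∣x∣≡0⇒x≡0 x ∣x∣≡))
  ... | just g = g , refl

  x≡0⇒abs[x]≡nothing : ∀ {x} → x ≡ 0# → abs x ≡ nothing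
  x≡0⇒abs[x]≡nothing x≡0 = trans (cong abs x≡0) ∣0∣≡0

  abs[1]≡one₀ : abs 1# ≡ one₀
  abs[1]≡one₀ with abs 1# in ∣1∣≡ | ∣xy∣ 1# 1#
  ... | nothing | _ = ⊥-elim (0≢1 (sym (∣x∣≡0⇒x≡0 1# ∣1∣≡)))
  ... | just g | ∣1·1∣≡g·g = cong just (VGP.identityʳ-unique g g (just-injective (begin
    just (g · g)    ≡⟨ ∣1·1∣≡g·g ⟨
    abs (1# * 1#)   ≡⟨ cong abs (R.*-identityˡ 1#) ⟩
    abs 1#          ≡⟨ ∣1∣≡ ⟩
    just g          ∎)))

  abs[-1]≡one₀ : abs (- 1#) ≡ one₀
  abs[-1]≡one₀ with abs (- 1#) in ∣-1∣≡ | ∣xy∣ (- 1#) (- 1#)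
  ... | nothing | _ = ⊥-elim (0≢1 (sym (+P.⁻¹-injective (trans (∣x∣≡0⇒x≡0 (- 1#) ∣-1∣≡) (sym RP.-0#≈0#)))))
  ... | just g | ∣-1·-1∣≡g·g = cong just (g·g≡ε⇒g≡ε g (just-injective (begin
    just (g · g)         ≡⟨ ∣-1·-1∣≡g·g ⟨
    abs (- 1# * - 1#)    ≡⟨ cong abs (trans (RP.-1*x≈-x (- 1#)) (+P.⁻¹-involutive 1#)) ⟩
    abs 1#               ≡⟨ abs[1]≡one₀ ⟩
    one₀                 ∎)))

  abs[-x]≡abs[x] : ∀ x → abs (- x) ≡ abs x
  abs[-x]≡abs[x] x = begin
    abs (- x)            ≡⟨ cong abs (RP.-1*x≈-x x) ⟨
    abs (- 1# * x)       ≡⟨ ∣xy∣ (- 1#) x ⟩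
    abs (- 1#) ⊗ abs x   ≡⟨ cong (_⊗ abs x) abs[-1]≡one₀ ⟩
    one₀ ⊗ abs x         ≡⟨ ⊗-identityˡ (abs x) ⟩
    abs x                ∎

  abs[x+y]≤₀ : ∀ x y {c} → abs x ≤₀ c → abs y ≤₀ c → abs (x + y) ≤₀ c
  abs[x+y]≤₀ x y {c} ∣x∣≤c ∣y∣≤c =
    [ (λ ≤∣x∣ → ≤₀-trans {abs (x + y)} {abs x} {c} ≤∣x∣ ∣x∣≤c)
    , (λ ≤∣y∣ → ≤₀-trans {abs (x + y)} {abs y} {c} ≤∣y∣ ∣y∣≤c) ]′ (ultra x y)

  abs[x+y]<₀ : ∀ x y {c} → abs x <₀ c → abs y <₀ c → abs (x + y) <₀ c
  abs[x+y]<₀ x y {c} ∣x∣<c ∣y∣<c =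
    [ (λ ≤∣x∣ → ≤₀-<₀-trans {abs (x + y)} {abs x} {c} ≤∣x∣ ∣x∣<c)
    , (λ ≤∣y∣ → ≤₀-<₀-trans {abs (x + y)} {abs y} {c} ≤∣y∣ ∣y∣<c) ]′ (ultra x y)

  abs[x-y]≤₀ : ∀ x y {c} → abs x ≤₀ c → abs y ≤₀ c → abs (x - y) ≤₀ c
  abs[x-y]≤₀ x y {c} ∣x∣≤c ∣y∣≤c = abs[x+y]≤₀ x (- y) ∣x∣≤c (subst (_≤₀ c) (sym (abs[-x]≡abs[x] y)) ∣y∣≤c)

  abs[x-y]<₀ : ∀ x y {c} → abs x <₀ c → abs y <₀ c → abs (x - y) <₀ c
  abs[x-y]<₀ x y {c} ∣x∣<c ∣y∣<c = abs[x+y]<₀ x (- y) ∣x∣<c (subst (_<₀ c) (sym (abs[-x]≡abs[x] y)) ∣y∣<c)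

  abs[n*x]≤₀abs[x] : ∀ n x → abs (natCast n * x) ≤₀ abs x
  abs[n*x]≤₀abs[x] zero x = subst (_≤₀ abs x) (sym (x≡0⇒abs[x]≡nothing (R.zeroˡ x))) tt
  abs[n*x]≤₀abs[x] (suc n) x = subst (_≤₀ abs x) (cong abs (sym (natCast-suc-* n x)))
    (abs[x+y]≤₀ x (natCast n * x) (≤₀-refl (abs x)) (abs[n*x]≤₀abs[x] n x))

  abs[n]≤₀one₀ : ∀ n → abs (natCast n) ≤₀ one₀
  abs[n]≤₀one₀ n = subst₂ _≤₀_ (cong abs (R.*-identityʳ (natCast n))) abs[1]≡one₀ (abs[n*x]≤₀abs[x] n 1#)

  RVEq-refl : ∀ L x → RVEq (just L) x x
  RVEq-refl L x with abs x in ∣x∣≡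
  ... | nothing = inj₁ (x≡0 , x≡0) where x≡0 = ∣x∣≡0⇒x≡0 x ∣x∣≡
  ... | just _ = inj₂ (x≢0 , x≢0 , subst (_<₀ just L) (sym (x≡0⇒abs[x]≡nothing xx⁻¹-1≡0)) (nothing<₀just L))
    where
      x≢0 = abs≡just⇒≢0 ∣x∣≡
      xx⁻¹-1≡0 : x * x ⁻¹ - 1# ≡ 0#
      xx⁻¹-1≡0 = trans (cong (_- 1#) (inverseʳ x x≢0)) (R.-‿inverseʳ 1#)

  RVEq⇒abs[x-y]<₀ : ∀ {L δ x y} → RVEq (just L) x y → abs y ≤₀ just δ → abs (x - y) <₀ just (L · δ)
  RVEq⇒abs[x-y]<₀ {L} {δ} (inj₁ (x≡0 , y≡0)) _ =
    subst (_<₀ just (L · δ)) (sym (x≡0⇒abs[x]≡nothing (trans (cong₂ _-_ x≡0 y≡0) (R.-‿inverseʳ 0#)))) (nothing<₀just _)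
  RVEq⇒abs[x-y]<₀ {L} {δ} {x} {y} (inj₂ (_ , y≢0 , ∣xy⁻¹-1∣<L)) ∣y∣≤δ =
    subst (_<₀ just (L · δ)) (sym ∣x-y∣≡)
      (<₀-≤₀-trans {q ⊗ just η} {just (L · η)} {just (L · δ)}
        (⊗-strictMonoˡ-<₀ η ∣xy⁻¹-1∣<L) (·-monoʳ L (subst (_≤₀ just δ) ∣y∣≡η ∣y∣≤δ)))
    where
      q = abs (x * y ⁻¹ - 1#)
      η = proj₁ (≢0⇒abs≡just y y≢0)
      ∣y∣≡η = proj₂ (≢0⇒abs≡just y y≢0)
      ∣x-y∣≡ : abs (x - y) ≡ q ⊗ just η
      ∣x-y∣≡ = trans (cong abs (sym ([xy⁻¹-1]y≡x-y x y y≢0))) (trans (∣xy∣ _ y) (cong (q ⊗_) ∣y∣≡η))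

  -- The walk

  module _ {L δ : Γ} (L≤ε : L ≤Γ ε) {d : K} (∣d∣≡δ : abs d ≡ just δ) where

    approximate-progression : (x : ℕ → K) → x 0 ≡ 0# → (∀ k → RVEq (just L) (x (suc k)) (x k - d)) →
                             ∀ k → abs (x k + natCast k * d) <₀ just (L · δ)
    approximate-progression x x₀≡0 _ zero =
      subst (_<₀ just (L · δ)) (sym (x≡0⇒abs[x]≡nothing x₀+0d≡0)) (nothing<₀just (L · δ))
      where
        x₀+0d≡0 : x 0 + 0# * d ≡ 0#
        x₀+0d≡0 = trans (cong₂ _+_ x₀≡0 (R.zeroˡ d)) (R.+-identityˡ 0#)
    approximate-progression x x₀≡0 close (suc k) =
      subst (λ t → abs t <₀ just (L · δ)) next≡ (abs[x+y]<₀ (x (suc k) - y) (x k + kd) step ih)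
      where
        kd = natCast k * d
        y = x k - d
        ih = approximate-progression x x₀≡0 close k
        Lδ≤δ : (L · δ) ≤Γ δ
        Lδ≤δ = subst ((L · δ) ≤Γ_) (VG.identityˡ δ) (·-monoˡ δ L≤ε)
        ∣y∣≤δ : abs y ≤₀ just δ
        ∣y∣≤δ = subst (λ t → abs t ≤₀ just δ) (+I.[x∙z]-[y∙z]≈x-y (x k) d kd)
          (abs[x-y]≤₀ (x k + kd) (d + kd) (≤₀-trans {abs (x k + kd)} {just (L · δ)} {just δ} (proj₁ ih) Lδ≤δ)
            (subst₂ _≤₀_ (cong abs (natCast-suc-* k d)) ∣d∣≡δ (abs[n*x]≤₀abs[x] (suc k) d)))
        step : abs (x (suc k) - y) <₀ just (L · δ)
        step = RVEq⇒abs[x-y]<₀ (close k) ∣y∣≤δ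
        next≡ : (x (suc k) - y) + (x k + kd) ≡ x (suc k) + natCast (suc k) * d
        next≡ = trans (+I.[w-[x-y]]∙[x∙z]≈w∙[y∙z] (x (suc k)) (x k) d kd)
                  (cong (x (suc k) +_) (sym (natCast-suc-* k d)))

    repeatedTerm⇒abs[m]<₀ : (x : ℕ → K) → (∀ k → abs (x k + natCast k * d) <₀ just (L · δ)) →
                            ∀ i m → x i ≡ x (i ℕ.+ m) → abs (natCast m) <₀ just L
    repeatedTerm⇒abs[m]<₀ x close i m xᵢ≡xᵢ₊ₘ =
      ⊗-cancelʳ-<₀ (abs (natCast m)) (just L) (just δ)
        (subst (_<₀ just (L · δ)) (trans (cong abs md≡) (trans (∣xy∣ _ d) (cong (abs (natCast m) ⊗_) ∣d∣≡δ)))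
          (abs[x-y]<₀ _ _ (close (i ℕ.+ m)) (close i)))
      where
        md≡ : (x (i ℕ.+ m) + natCast (i ℕ.+ m) * d) - (x i + natCast i * d) ≡ natCast m * d
        md≡ = begin
          (x (i ℕ.+ m) + natCast (i ℕ.+ m) * d) - (x i + natCast i * d)
            ≡⟨ cong (λ t → (t + natCast (i ℕ.+ m) * d) - (x i + natCast i * d)) (sym xᵢ≡xᵢ₊ₘ) ⟩
          (x i + natCast (i ℕ.+ m) * d) - (x i + natCast i * d)
            ≡⟨ cong (λ t → (x i + t * d) - (x i + natCast i * d)) (natCast-+ i m) ⟩
          (x i + (natCast i + natCast m) * d) - (x i + natCast i * d)
            ≡⟨ cong (λ t → (x i + t) - (x i + natCast i * d)) (R.distribʳ d (natCast i) (natCast m)) ⟩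
          (x i + (natCast i * d + natCast m * d)) - (x i + natCast i * d)
            ≡⟨ +I.[x∙[y∙z]]-[x∙y]≈z (x i) (natCast i * d) (natCast m * d) ⟩
          natCast m * d ∎

  NoSmallMultiples : Γ → ℕ → Set
  NoSmallMultiples L n = ∀ m → 1 ≤ m → m ≤ n → ¬ (abs (natCast m) <₀ just L)

  RVSetEq⇒≡ : ∀ {L A a a'} → L ≤Γ ε → NoSmallMultiples L (length A) → a ∈ A →
              RVSetEq (just L) A a a' → a ≡ a'
  RVSetEq⇒≡ {L} {A} {a} {a'} L≤ε noSmall a∈A (_ , pred) with abs (a - a') in ∣d∣≡
  ... | nothing = x-y≡0⇒x≡y a a' (∣x∣≡0⇒x≡0 (a - a') ∣d∣≡)
  ... | just δ with predecessor-walk A pred a∈A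
  ... | v , v₀≡a , v∈A , related with walk-repeats A v v∈A
  ... | i , m , 1≤m , m≤#A , vᵢ≡vᵢ₊ₘ = ⊥-elim (noSmall m 1≤m m≤#A
    (repeatedTerm⇒abs[m]<₀ L≤ε ∣d∣≡ x (approximate-progression L≤ε ∣d∣≡ x x₀≡0 close) i m (cong (λ w → a - w) vᵢ≡vᵢ₊ₘ)))
    where
      x : ℕ → K
      x k = a - v k
      x₀≡0 : x 0 ≡ 0#
      x₀≡0 = trans (cong (λ w → a - w) v₀≡a) (R.-‿inverseʳ a)
      close : ∀ k → RVEq (just L) (x (suc k)) (x k - (a - a'))
      close k = subst (RVEq (just L) (x (suc k))) (sym (+I.[x-z]-[x-y]≈y-z a a' (v k))) (related k)

  ≡⇔RVSetEq : ∀ {L A a a'} → L ≤Γ ε → NoSmallMultiples L (length A) → a ∈ A →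
              (a ≡ a') ⇔ RVSetEq (just L) A a a'
  ≡⇔RVSetEq {L} L≤ε noSmall a∈A = mk⇔
    (λ { refl → (λ v v∈A → v , v∈A , RVEq-refl L _) , (λ v v∈A → v , v∈A , RVEq-refl L _) })
    (RVSetEq⇒≡ L≤ε noSmall a∈A)

  -- Lower bounds for |m|

  abs[m*n]≡abs[m]⊗abs[n] : ∀ m n → abs (natCast (m ℕ.* n)) ≡ abs (natCast m) ⊗ abs (natCast n)
  abs[m*n]≡abs[m]⊗abs[n] m n = trans (cong abs (natCast-* m n)) (∣xy∣ (natCast m) (natCast n))

  nonzeroDigit⇒¬InMaxIdeal : ∀ {p} → ResidueChar p → ∀ {r} q → 1 ≤ r → r < p →
                              ¬ InMaxIdeal (natCast (r ℕ.+ q ℕ.* p))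
  nonzeroDigit⇒¬InMaxIdeal {p} (_ , p∈𝔪 , minimal) {r} q 1≤r r<p m∈𝔪 =
    minimal r 1≤r r<p (subst (_<₀ one₀) (cong abs r≡) (abs[x-y]<₀ _ _ m∈𝔪 qp∈𝔪))
    where
      qp = natCast q * natCast p
      qp∈𝔪 : abs qp <₀ one₀
      qp∈𝔪 = ≤₀-<₀-trans {abs qp} {abs (natCast p)} {one₀} (abs[n*x]≤₀abs[x] q (natCast p)) p∈𝔪
      r≡ : natCast (r ℕ.+ q ℕ.* p) - qp ≡ natCast r
      r≡ = trans (cong (_- qp) (trans (natCast-+ r (q ℕ.* p)) (cong (natCast r +_) (natCast-* q p))))
                 (+P.//-rightDividesʳ qp (natCast r))

  abs[m]≮abs[p^ℓ] : ∀ {p} → ResidueChar p → ∀ ℓ m → 1 ≤ m → m < p ^ ℓ →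
                    ¬ (abs (natCast m) <₀ abs (natCast (p ^ ℓ)))
  abs[m]≮abs[p^ℓ] {zero} (() , _)
  abs[m]≮abs[p^ℓ] {suc p'} char zero (suc m) _ (s≤s ())
  abs[m]≮abs[p^ℓ] {suc p'} char (suc ℓ) m 1≤m m<p^ℓ ∣m∣<∣p^ℓ∣ =
    digits (m % p) (m / p) (m≡m%n+[m/n]*n m p) (m%n<n m p)
    where
      p = suc p'
      digits : ∀ r q → m ≡ r ℕ.+ q ℕ.* p → r < p → ⊥
      digits zero zero m≡0 _ with () ← subst (1 ≤_) m≡0 1≤m
      digits zero (suc q') m≡qp _ =
        abs[m]≮abs[p^ℓ] char ℓ q (s≤s z≤n)
          (*-cancelʳ-< p q (p ^ ℓ) (subst₂ _<_ m≡qp (*-comm p (p ^ ℓ)) m<p^ℓ))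
          (⊗-cancelʳ-<₀ (abs (natCast q)) (abs (natCast (p ^ ℓ))) (abs (natCast p))
            (subst₂ _<₀_ (trans (cong (abs ∘′ natCast) m≡qp) (abs[m*n]≡abs[m]⊗abs[n] q p))
                         (trans (cong (abs ∘′ natCast) (*-comm p (p ^ ℓ))) (abs[m*n]≡abs[m]⊗abs[n] (p ^ ℓ) p))
                         ∣m∣<∣p^ℓ∣))
        where q = suc q'
      digits (suc r) q m≡ r<p =
        nonzeroDigit⇒¬InMaxIdeal char q (s≤s z≤n) r<p
          (subst (λ n → InMaxIdeal (natCast n)) m≡
            (<₀-≤₀-trans {abs (natCast m)} ∣m∣<∣p^ℓ∣ (abs[n]≤₀one₀ (p ^ suc ℓ))))

  ≡⇔RVSetEq-residueChar : CharZero → ∀ {p} ℓ → ResidueChar p → ∀ {A a a'} → length A < p ^ ℓ → a ∈ A →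
                          (a ≡ a') ⇔ RVSetEq (abs (natCast (p ^ ℓ))) A a a'
  ≡⇔RVSetEq-residueChar _ {zero} _ (() , _)
  ≡⇔RVSetEq-residueChar charZero {suc p'} ℓ char {A} #A<p^ℓ a∈A with abs (natCast (suc p' ^ ℓ)) in ∣p^ℓ∣≡
  ... | nothing = ⊥-elim (natCast[p^ℓ]≢0 (∣x∣≡0⇒x≡0 _ ∣p^ℓ∣≡))
    where
      natCast[p^ℓ]≢0 : natCast (suc p' ^ ℓ) ≢ 0#
      natCast[p^ℓ]≢0 with suc p' ^ ℓ | m^n>0 (suc p') ℓ
      ... | zero  | ()
      ... | suc n | _ = charZero n
  ... | just L = ≡⇔RVSetEq L≤ε noSmall a∈A
    where
      L≤ε : L ≤Γ ε
      L≤ε = subst (_≤₀ one₀) ∣p^ℓ∣≡ (abs[n]≤₀one₀ (suc p' ^ ℓ))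
      noSmall : NoSmallMultiples L (length A)
      noSmall m 1≤m m≤#A ∣m∣<L = abs[m]≮abs[p^ℓ] char ℓ m 1≤m (≤-<-trans m≤#A #A<p^ℓ)
        (subst (abs (natCast m) <₀_) (sym ∣p^ℓ∣≡) ∣m∣<L)

  ≡⇔RVSetEq-residueCharZero : ResidueCharZero → ∀ {A a a'} → a ∈ A → (a ≡ a') ⇔ RVSetEq one₀ A a a'
  ≡⇔RVSetEq-residueCharZero residueCharZero a∈A = ≡⇔RVSetEq ≤Γ.refl noSmall a∈A
    where
      noSmall : ∀ {n} → NoSmallMultiples ε n
      noSmall (suc m) _ _ = residueCharZero m

lemma2p2 : (V : ValuedField) → let open ValuedField V in
    CharZero → (A : List K) → Unique A →
    ((p ℓ : ℕ) → ResidueChar p → length A < p ^ ℓ →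
    ∀ a a' → a ∈ A → a' ∈ A → ((a ≡ a') ⇔ RVSetEq (abs (natCast (p ^ ℓ))) A a a'))
    × (ResidueCharZero →
    ∀ a a' → a ∈ A → a' ∈ A → ((a ≡ a') ⇔ RVSetEq one₀ A a a'))
lemma2p2 V charZero A _ =
  (λ p ℓ char #A<p^ℓ _ _ a∈A _ → ≡⇔RVSetEq-residueChar V charZero ℓ char #A<p^ℓ a∈A) ,
  (λ char₀ _ _ a∈A _ → ≡⇔RVSetEq-residueCharZero V char₀ a∈A)
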